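{- Let $\Gamma$, $\theta$ be as in the context. For any $\gamma_1,\dots,\gamma_m\in\Gamma$ and integers $k_1,\dots,k_m$, $$\theta(\gamma_1^{k_1}\cdots\gamma_m^{k_m})=\sum_{i=1}^m k_i\,\theta(\gamma_i)+\tfrac12\sum_{1\le i<j\le m}k_ik_j\,\theta([\gamma_i,\gamma_j]),$$ where $[\gamma,\tau]=\gamma\tau\gamma^{ -1}\tau^{ -1}$.
   Context: Let $\Gamma\subset \mathrm{SL}(2,\mathbb{R})$ be a Fuchsian group of the first kind (discrete, finite covolume $V_\Gamma$) with a cusp at $\infty$, normalized so that $P_\infty=\left(\begin{smallmatrix}1&1\\0&1\end{smallmatrix}\right)\in\Gamma$ and the stabilizer $\Gamma_\infty$ of $\infty$ is generated by $P_\infty$ and $-I$ if $-I\in\Gamma$; assume $\Gamma\backslash\mathbb{H}$ has positive genus and fix a nonzero weight 2 holomorphic cusp form $f$ for $\Gamma$ with Petersson norm $\|f\|$. Modular symbol $\langle\gamma,f\rangle=2\pi i\int_{z_0}^{\gamma z_0}f(w)dw$ (independent of $z_0$, additive in $\gamma$). $V_f=V_\Gamma/(16\pi^2\|f\|^2)$. $S$ is the modular Dedekind symbol (defined by $\log\eta_{\Gamma,\infty}(\gamma z)=\log\eta_{\Gamma,\infty}(z)+\tfrac12\log(c_\gamma z+d_\gamma)+\pi iS(\gamma)$, $\eta_{\Gamma,\infty}$ from the Kronecker limit formula of $E_\infty(z,s)=\sum_{\Gamma_\infty\backslash\Gamma}\mathrm{Im}(\gamma z)^s$ at $s=1$), and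 $S^*$ the higher-order modular Dedekind symbol of Jorgenson–O'Sullivan–Smajlović, defined analogously from the Kronecker limit at $s=1$ of $\sum_{\Gamma_\infty\backslash\Gamma}|\langle\gamma,f\rangle|^{2m}\mathrm{Im}(\gamma z)^s$. $\theta:=S^*-S$, and it is known that $\theta(\gamma\tau)=\theta(\gamma)+\theta(\tau)+\frac{V_f}{2\pi}\mathrm{Im}(\langle\gamma,f\rangle\overline{\langle\tau,f\rangle})$ for all $\gamma,\tau\in\Gamma$. -}

module Defs where

open import Algebra.Bundles using (Group; CommutativeRing)
open import Data.Integer using (ℤ; +_; -[1+_])
open import Data.Nat using (ℕ; zero; suc)
open import Data.Fin using (Fin; zero; suc)
open import Function using (_∘_)

module _ {a b} (G : Group a b) where
  open Group G

  powℕ : Carrier → ℕ → Carrier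
  powℕ g zero    = ε
  powℕ g (suc n) = g ∙ powℕ g n

  powℤ : Carrier → ℤ → Carrier
  powℤ g (+ n)    = powℕ g n
  powℤ g -[1+ n ] = (powℕ g (suc n)) ⁻¹

  commutator : Carrier → Carrier → Carrier
  commutator g t = ((g ∙ t) ∙ g ⁻¹) ∙ t ⁻¹

  prodPow : (m : ℕ) → (Fin m → Carrier) → (Fin m → ℤ) → Carrier
  prodPow zero    γ k = ε
  prodPow (suc m) γ k = powℤ (γ zero) (k zero) ∙ prodPow m (γ ∘ suc) (k ∘ suc)

module _ {c ℓ} (R : CommutativeRing c ℓ) where
  open CommutativeRing R hiding (zero)

  fromℕ : ℕ → Carrier
  fromℕ zero    = 0#
  fromℕ (suc n) = 1# + fromℕ n

  fromℤ : ℤ → Carrier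
  fromℤ (+ n)    = fromℕ n
  fromℤ -[1+ n ] = - fromℕ (suc n)

  sumFin : (m : ℕ) → (Fin m → Carrier) → Carrier
  sumFin zero    f = 0#
  sumFin (suc m) f = f zero + sumFin m (f ∘ suc)

  -- Σ_{1 ≤ i < j ≤ m} f i j
  sumPairs : (m : ℕ) → (Fin m → Fin m → Carrier) → Carrier
  sumPairs zero    f = 0#
  sumPairs (suc m) f = sumFin m (λ j → f zero (suc j)) + sumPairs m (λ i j → f (suc i) (suc j))

-- The modular symbol makes B(g,t) = κ·Im(⟨g,f⟩·conj⟨t,f⟩) an alternating biadditive form on Γ,
-- and θ is a quasimorphism with defect B. Since B(g,gⁿ) = n·B(g,g) = 0, θ is additive along
-- powers, so θ(g^k) = k·θ(g), while θ[g,t] = θ(gt) − θ(tg) = 2B(g,t).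
-- Induction on m then gives the formula: the defect B(γ₁^k₁, γ₂^k₂⋯γₘ^kₘ) expands
-- biadditively into Σⱼ k₁kⱼ·B(γ₁,γⱼ) = ½ Σⱼ k₁kⱼ·θ[γ₁,γⱼ].

module Submission where

open import Defs
open import Level using (_⊔_)
open import Algebra.Bundles using (Group; CommutativeRing)
open import Algebra.Morphism.Structures using (module MagmaMorphisms)
open import Data.Integer using (ℤ; +_; -[1+_])
open import Data.Nat using (ℕ; zero; suc)
open import Data.Fin using (Fin; zero; suc)
open import Data.Product using (_×_; proj₁; proj₂)
open import Function using (_∘_)
import Algebra.Properties.CommutativeSemigroup as CommutativeSemigroupProperties
import Algebra.Properties.Group as GroupProperties
import Algebra.Properties.Ring as RingProperties
import Relation.Binary.Reasoning.Setoid as SetoidReasoning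

module _ {a b c ℓ} (Γ : Group a b) (R : CommutativeRing c ℓ) where

  open Group Γ using (_∙_; ε; _⁻¹; identityˡ; inverseʳ)
    renaming (Carrier to G; _≈_ to _≈ᴳ_; trans to transᴳ)
  open GroupProperties Γ using (⁻¹-anti-homo-∙)
  open CommutativeRing R hiding (zero)
  open RingProperties ring
    using (-0#≈0#; -‿involutive; -‿distribˡ-*; -‿+-comm; x+x≈x⇒x≈0; +-inverseʳ-unique)
  open CommutativeSemigroupProperties +-commutativeSemigroup using (interchange)
  open CommutativeSemigroupProperties *-commutativeSemigroup using (x∙yz≈y∙xz)
  open MagmaMorphisms (Group.rawMagma Γ) +-rawMagma using (IsMagmaHomomorphism; module IsMagmaHomomorphism)
  open SetoidReasoning setoid

  -‿interchange : ∀ w x y z → (w + x) - (y + z) ≈ (w - y) + (x - z)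
  -‿interchange w x y z = begin
    (w + x) + - (y + z)    ≈⟨ +-congˡ (-‿+-comm y z) ⟨
    (w + x) + (- y + - z)  ≈⟨ interchange w x (- y) (- z) ⟩
    (w - y) + (x - z)      ∎

  fromℕ-suc-* : ∀ n x → fromℕ R (suc n) * x ≈ x + fromℕ R n * x
  fromℕ-suc-* n x = begin
    (1# + fromℕ R n) * x     ≈⟨ distribʳ x 1# (fromℕ R n) ⟩
    1# * x + fromℕ R n * x   ≈⟨ +-congʳ (*-identityˡ x) ⟩
    x + fromℕ R n * x        ∎

  odd∧ℕ-homogeneous⇒ℤ-homogeneous : (φ : G → Carrier) →
    (∀ g → φ (g ⁻¹) ≈ - φ g) → (∀ g n → φ (powℕ Γ g n) ≈ fromℕ R n * φ g) →
    ∀ g k → φ (powℤ Γ g k) ≈ fromℤ R k * φ g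
  odd∧ℕ-homogeneous⇒ℤ-homogeneous φ φ-⁻¹ φ-powℕ g (+ n)    = φ-powℕ g n
  odd∧ℕ-homogeneous⇒ℤ-homogeneous φ φ-⁻¹ φ-powℕ g -[1+ n ] = begin
    φ (powℕ Γ g (suc n) ⁻¹)       ≈⟨ φ-⁻¹ (powℕ Γ g (suc n)) ⟩
    - φ (powℕ Γ g (suc n))        ≈⟨ -‿cong (φ-powℕ g (suc n)) ⟩
    - (fromℕ R (suc n) * φ g)     ≈⟨ -‿distribˡ-* (fromℕ R (suc n)) (φ g) ⟩
    - fromℕ R (suc n) * φ g       ∎

  sumFin-cong : ∀ m {f g : Fin m → Carrier} → (∀ i → f i ≈ g i) → sumFin R m f ≈ sumFin R m g
  sumFin-cong zero    f≈g = refl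
  sumFin-cong (suc m) f≈g = +-cong (f≈g zero) (sumFin-cong m (f≈g ∘ suc))

  *-distribˡ-sumFin : ∀ m x (f : Fin m → Carrier) → x * sumFin R m f ≈ sumFin R m (λ i → x * f i)
  *-distribˡ-sumFin zero    x f = zeroʳ x
  *-distribˡ-sumFin (suc m) x f =
    trans (distribˡ x (f zero) (sumFin R m (f ∘ suc))) (+-congˡ (*-distribˡ-sumFin m x (f ∘ suc)))

  module AdditiveMap {f : G → Carrier} (f-additive : IsMagmaHomomorphism f) where
    open IsMagmaHomomorphism f-additive using (⟦⟧-cong; homo)

    f-ε : f ε ≈ 0#
    f-ε = x+x≈x⇒x≈0 (f ε) (trans (sym (homo ε ε)) (⟦⟧-cong (identityˡ ε)))

    f-⁻¹ : ∀ g → f (g ⁻¹) ≈ - f g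
    f-⁻¹ g = +-inverseʳ-unique (f g) (f (g ⁻¹)) (trans (sym (homo g (g ⁻¹))) (trans (⟦⟧-cong (inverseʳ g)) f-ε))

    f-powℕ : ∀ g n → f (powℕ Γ g n) ≈ fromℕ R n * f g
    f-powℕ g zero    = trans f-ε (sym (zeroˡ (f g)))
    f-powℕ g (suc n) = begin
      f (g ∙ powℕ Γ g n)      ≈⟨ homo g (powℕ Γ g n) ⟩
      f g + f (powℕ Γ g n)    ≈⟨ +-congˡ (f-powℕ g n) ⟩
      f g + fromℕ R n * f g   ≈⟨ fromℕ-suc-* n (f g) ⟨
      fromℕ R (suc n) * f g   ∎

    f-powℤ : ∀ g k → f (powℤ Γ g k) ≈ fromℤ R k * f g
    f-powℤ = odd∧ℕ-homogeneous⇒ℤ-homogeneous f f-⁻¹ f-powℕ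

    f-prodPow : ∀ m γ k → f (prodPow Γ m γ k) ≈ sumFin R m (λ i → fromℤ R (k i) * f (γ i))
    f-prodPow zero    γ k = f-ε
    f-prodPow (suc m) γ k =
      trans (homo _ _) (+-cong (f-powℤ (γ zero) (k zero)) (f-prodPow m (γ ∘ suc) (k ∘ suc)))

  record IsAlternatingBiadditive (B : G → G → Carrier) : Set (a ⊔ b ⊔ ℓ) where
    field
      additiveˡ   : ∀ t → IsMagmaHomomorphism (λ g → B g t)
      additiveʳ   : ∀ g → IsMagmaHomomorphism (B g)
      alternating : ∀ g → B g g ≈ 0#

  determinant-isAlternatingBiadditive : ∀ {X Y} → IsMagmaHomomorphism X → IsMagmaHomomorphism Y →
    ∀ κ → IsAlternatingBiadditive (λ g t → κ * (Y g * X t - X g * Y t))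
  determinant-isAlternatingBiadditive {X} {Y} X-additive Y-additive κ = record
    { additiveˡ   = λ t → record
      { isRelHomomorphism = record
        { cong = λ g≈h → *-congˡ (+-cong (*-congʳ (Y.⟦⟧-cong g≈h)) (-‿cong (*-congʳ (X.⟦⟧-cong g≈h)))) }
      ; homo = homoˡ t
      }
    ; additiveʳ   = λ g → record
      { isRelHomomorphism = record
        { cong = λ t≈u → *-congˡ (+-cong (*-congˡ (X.⟦⟧-cong t≈u)) (-‿cong (*-congˡ (Y.⟦⟧-cong t≈u)))) }
      ; homo = homoʳ g
      }
    ; alternating = λ g → begin
        κ * (Y g * X g - X g * Y g)   ≈⟨ *-congˡ (+-congˡ (-‿cong (*-comm (X g) (Y g)))) ⟩
        κ * (Y g * X g - Y g * X g)   ≈⟨ *-congˡ (-‿inverseʳ (Y g * X g)) ⟩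
        κ * 0#                        ≈⟨ zeroʳ κ ⟩
        0#                            ∎
    }
    where
    module X = IsMagmaHomomorphism X-additive
    module Y = IsMagmaHomomorphism Y-additive

    homoˡ : ∀ t g h → κ * (Y (g ∙ h) * X t - X (g ∙ h) * Y t)
                    ≈ κ * (Y g * X t - X g * Y t) + κ * (Y h * X t - X h * Y t)
    homoˡ t g h = begin
      κ * (Y (g ∙ h) * X t - X (g ∙ h) * Y t)
        ≈⟨ *-congˡ (+-cong (*-congʳ (Y.homo g h)) (-‿cong (*-congʳ (X.homo g h)))) ⟩
      κ * ((Y g + Y h) * X t - (X g + X h) * Y t)
        ≈⟨ *-congˡ (+-cong (distribʳ (X t) (Y g) (Y h)) (-‿cong (distribʳ (Y t) (X g) (X h)))) ⟩
      κ * ((Y g * X t + Y h * X t) - (X g * Y t + X h * Y t))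
        ≈⟨ *-congˡ (-‿interchange _ _ _ _) ⟩
      κ * ((Y g * X t - X g * Y t) + (Y h * X t - X h * Y t))
        ≈⟨ distribˡ κ _ _ ⟩
      κ * (Y g * X t - X g * Y t) + κ * (Y h * X t - X h * Y t) ∎

    homoʳ : ∀ g t u → κ * (Y g * X (t ∙ u) - X g * Y (t ∙ u))
                    ≈ κ * (Y g * X t - X g * Y t) + κ * (Y g * X u - X g * Y u)
    homoʳ g t u = begin
      κ * (Y g * X (t ∙ u) - X g * Y (t ∙ u))
        ≈⟨ *-congˡ (+-cong (*-congˡ (X.homo t u)) (-‿cong (*-congˡ (Y.homo t u)))) ⟩
      κ * (Y g * (X t + X u) - X g * (Y t + Y u))
        ≈⟨ *-congˡ (+-cong (distribˡ (Y g) (X t) (X u)) (-‿cong (distribˡ (X g) (Y t) (Y u)))) ⟩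
      κ * ((Y g * X t + Y g * X u) - (X g * Y t + X g * Y u))
        ≈⟨ *-congˡ (-‿interchange _ _ _ _) ⟩
      κ * ((Y g * X t - X g * Y t) + (Y g * X u - X g * Y u))
        ≈⟨ distribˡ κ _ _ ⟩
      κ * (Y g * X t - X g * Y t) + κ * (Y g * X u - X g * Y u) ∎

  module QuasiMorphism {B : G → G → Carrier} (B-isAlternatingBiadditive : IsAlternatingBiadditive B)
    {θ : G → Carrier} (θ-cong : ∀ {g t} → g ≈ᴳ t → θ g ≈ θ t)
    (θ-∙ : ∀ g t → θ (g ∙ t) ≈ (θ g + θ t) + B g t) where

    open IsAlternatingBiadditive B-isAlternatingBiadditive
    module Bˡ t = AdditiveMap (additiveˡ t)
    module Bʳ g = AdditiveMap (additiveʳ g)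

    B-∙-∙ : ∀ g t u v → B (g ∙ t) (u ∙ v) ≈ (B g u + B g v) + (B t u + B t v)
    B-∙-∙ g t u v = trans (IsMagmaHomomorphism.homo (additiveˡ (u ∙ v)) g t)
      (+-cong (IsMagmaHomomorphism.homo (additiveʳ g) u v) (IsMagmaHomomorphism.homo (additiveʳ t) u v))

    B-skew : ∀ g t → B g t + B t g ≈ 0#
    B-skew g t = begin
      B g t + B t g                     ≈⟨ +-cong (+-identityˡ (B g t)) (+-identityʳ (B t g)) ⟨
      (0# + B g t) + (B t g + 0#)       ≈⟨ +-cong (+-congʳ (alternating g)) (+-congˡ (alternating t)) ⟨
      (B g g + B g t) + (B t g + B t t) ≈⟨ B-∙-∙ g t g t ⟨
      B (g ∙ t) (g ∙ t)                 ≈⟨ alternating (g ∙ t) ⟩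
      0#                                ∎

    B-antisym : ∀ g t → B t g ≈ - B g t
    B-antisym g t = +-inverseʳ-unique (B g t) (B t g) (B-skew g t)

    θ-∙-orthogonal : ∀ {g t} → B g t ≈ 0# → θ (g ∙ t) ≈ θ g + θ t
    θ-∙-orthogonal {g} {t} Bgt≈0 = trans (θ-∙ g t) (trans (+-congˡ Bgt≈0) (+-identityʳ (θ g + θ t)))

    θ-ε : θ ε ≈ 0#
    θ-ε = x+x≈x⇒x≈0 (θ ε) (trans (sym (θ-∙-orthogonal (alternating ε))) (θ-cong (identityˡ ε)))

    θ-⁻¹ : ∀ g → θ (g ⁻¹) ≈ - θ g
    θ-⁻¹ g = +-inverseʳ-unique (θ g) (θ (g ⁻¹))
      (trans (sym (θ-∙-orthogonal B-g-g⁻¹≈0)) (trans (θ-cong (inverseʳ g)) θ-ε))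
      where
      B-g-g⁻¹≈0 : B g (g ⁻¹) ≈ 0#
      B-g-g⁻¹≈0 = trans (Bʳ.f-⁻¹ g g) (trans (-‿cong (alternating g)) -0#≈0#)

    θ-powℕ : ∀ g n → θ (powℕ Γ g n) ≈ fromℕ R n * θ g
    θ-powℕ g zero    = trans θ-ε (sym (zeroˡ (θ g)))
    θ-powℕ g (suc n) = begin
      θ (g ∙ powℕ Γ g n)      ≈⟨ θ-∙-orthogonal B-g-gⁿ≈0 ⟩
      θ g + θ (powℕ Γ g n)    ≈⟨ +-congˡ (θ-powℕ g n) ⟩
      θ g + fromℕ R n * θ g   ≈⟨ fromℕ-suc-* n (θ g) ⟨
      fromℕ R (suc n) * θ g   ∎
      where
      B-g-gⁿ≈0 : B g (powℕ Γ g n) ≈ 0#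
      B-g-gⁿ≈0 = trans (Bʳ.f-powℕ g g n) (trans (*-congˡ (alternating g)) (zeroʳ (fromℕ R n)))

    θ-powℤ : ∀ g k → θ (powℤ Γ g k) ≈ fromℤ R k * θ g
    θ-powℤ = odd∧ℕ-homogeneous⇒ℤ-homogeneous θ θ-⁻¹ θ-powℕ

    θ-∙-⁻¹ : ∀ g t → θ (g ∙ t ⁻¹) ≈ (θ g - θ t) - B g t
    θ-∙-⁻¹ g t = trans (θ-∙ g (t ⁻¹)) (+-cong (+-congˡ (θ-⁻¹ t)) (Bʳ.f-⁻¹ g t))

    θ-∙-swap : ∀ g t → θ (g ∙ t) - θ (t ∙ g) ≈ B g t + B g t
    θ-∙-swap g t = begin
      θ (g ∙ t) - θ (t ∙ g)                               ≈⟨ +-cong (θ-∙ g t) (-‿cong (θ-∙ t g)) ⟩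
      ((θ g + θ t) + B g t) - ((θ t + θ g) + B t g)       ≈⟨ -‿interchange _ _ _ _ ⟩
      ((θ g + θ t) - (θ t + θ g)) + (B g t - B t g)       ≈⟨ +-cong θ-cancel (+-congˡ (-‿cong (B-antisym g t))) ⟩
      0# + (B g t - - B g t)                              ≈⟨ +-identityˡ _ ⟩
      B g t - - B g t                                     ≈⟨ +-congˡ (-‿involutive (B g t)) ⟩
      B g t + B g t                                       ∎
      where
      θ-cancel : (θ g + θ t) - (θ t + θ g) ≈ 0#
      θ-cancel = trans (+-congˡ (-‿cong (+-comm (θ t) (θ g)))) (-‿inverseʳ (θ g + θ t))

    B-∙-swap : ∀ g t → B (g ∙ t) (t ∙ g) ≈ 0#
    B-∙-swap g t = begin
      B (g ∙ t) (t ∙ g)                 ≈⟨ B-∙-∙ g t t g ⟩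
      (B g t + B g g) + (B t t + B t g) ≈⟨ +-cong (+-congˡ (alternating g)) (+-congʳ (alternating t)) ⟩
      (B g t + 0#) + (0# + B t g)       ≈⟨ +-cong (+-identityʳ (B g t)) (+-identityˡ (B t g)) ⟩
      B g t + B t g                     ≈⟨ B-skew g t ⟩
      0#                                ∎

    θ-commutator : ∀ g t → θ (commutator Γ g t) ≈ B g t + B g t
    θ-commutator g t = begin
      θ (((g ∙ t) ∙ g ⁻¹) ∙ t ⁻¹)                      ≈⟨ θ-cong commutator≈ ⟩
      θ ((g ∙ t) ∙ (t ∙ g) ⁻¹)                         ≈⟨ θ-∙-⁻¹ (g ∙ t) (t ∙ g) ⟩
      (θ (g ∙ t) - θ (t ∙ g)) - B (g ∙ t) (t ∙ g)      ≈⟨ +-cong (θ-∙-swap g t) (-‿cong (B-∙-swap g t)) ⟩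
      (B g t + B g t) - 0#                             ≈⟨ trans (+-congˡ -0#≈0#) (+-identityʳ _) ⟩
      B g t + B g t                                    ∎
      where
      commutator≈ : ((g ∙ t) ∙ g ⁻¹) ∙ t ⁻¹ ≈ᴳ (g ∙ t) ∙ (t ∙ g) ⁻¹
      commutator≈ = transᴳ (Group.assoc Γ (g ∙ t) (g ⁻¹) (t ⁻¹))
                           (Group.∙-congˡ Γ (Group.sym Γ (⁻¹-anti-homo-∙ t g)))

    module _ {half : Carrier} (half+half≈1 : half + half ≈ 1#) where

      half*θ-commutator : ∀ g t → half * θ (commutator Γ g t) ≈ B g t
      half*θ-commutator g t = begin
        half * θ (commutator Γ g t)   ≈⟨ *-congˡ (θ-commutator g t) ⟩
        half * (B g t + B g t)        ≈⟨ distribˡ half (B g t) (B g t) ⟩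
        half * B g t + half * B g t   ≈⟨ distribʳ (B g t) half half ⟨
        (half + half) * B g t         ≈⟨ *-congʳ half+half≈1 ⟩
        1# * B g t                    ≈⟨ *-identityˡ (B g t) ⟩
        B g t                         ∎

      B-powℤ-prodPow : ∀ g k m γ (l : Fin m → ℤ) → B (powℤ Γ g k) (prodPow Γ m γ l)
        ≈ half * sumFin R m (λ j → (fromℤ R k * fromℤ R (l j)) * θ (commutator Γ g (γ j)))
      B-powℤ-prodPow g k m γ l = begin
        B (powℤ Γ g k) (prodPow Γ m γ l)
          ≈⟨ Bˡ.f-powℤ (prodPow Γ m γ l) g k ⟩
        K * B g (prodPow Γ m γ l)
          ≈⟨ *-congˡ (Bʳ.f-prodPow g m γ l) ⟩
        K * sumFin R m (λ j → L j * B g (γ j))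
          ≈⟨ *-distribˡ-sumFin m K _ ⟩
        sumFin R m (λ j → K * (L j * B g (γ j)))
          ≈⟨ sumFin-cong m (λ j → *-congˡ (*-congˡ (half*θ-commutator g (γ j)))) ⟨
        sumFin R m (λ j → K * (L j * (half * C j)))
          ≈⟨ sumFin-cong m (λ j → trans (sym (*-assoc K (L j) (half * C j))) (x∙yz≈y∙xz (K * L j) half (C j))) ⟩
        sumFin R m (λ j → half * ((K * L j) * C j))
          ≈⟨ *-distribˡ-sumFin m half _ ⟨
        half * sumFin R m (λ j → (K * L j) * C j) ∎
        where
        K : Carrier
        K = fromℤ R k
        L C : Fin m → Carrier
        L = fromℤ R ∘ l
        C j = θ (commutator Γ g (γ j))

      θ-prodPow : ∀ m γ k → θ (prodPow Γ m γ k) ≈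
        sumFin R m (λ i → fromℤ R (k i) * θ (γ i))
        + half * sumPairs R m (λ i j → (fromℤ R (k i) * fromℤ R (k j)) * θ (commutator Γ (γ i) (γ j)))
      θ-prodPow zero    γ k = trans θ-ε (sym (trans (+-identityˡ (half * 0#)) (zeroʳ half)))
      θ-prodPow (suc m) γ k = begin
        θ (P ∙ Q)                                    ≈⟨ θ-∙ P Q ⟩
        (θ P + θ Q) + B P Q
          ≈⟨ +-cong (+-cong (θ-powℤ (γ zero) (k zero)) (θ-prodPow m (γ ∘ suc) (k ∘ suc)))
                    (B-powℤ-prodPow (γ zero) (k zero) m (γ ∘ suc) (k ∘ suc)) ⟩
        (head + (tail + half * pairsᵗ)) + half * pairsʰ  ≈⟨ +-congʳ (+-assoc head tail (half * pairsᵗ)) ⟨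
        ((head + tail) + half * pairsᵗ) + half * pairsʰ  ≈⟨ +-assoc (head + tail) (half * pairsᵗ) (half * pairsʰ) ⟩
        (head + tail) + (half * pairsᵗ + half * pairsʰ)  ≈⟨ +-congˡ (+-comm (half * pairsᵗ) (half * pairsʰ)) ⟩
        (head + tail) + (half * pairsʰ + half * pairsᵗ)  ≈⟨ +-congˡ (distribˡ half pairsʰ pairsᵗ) ⟨
        (head + tail) + half * (pairsʰ + pairsᵗ)         ∎
        where
        P Q : G
        P = powℤ Γ (γ zero) (k zero)
        Q = prodPow Γ m (γ ∘ suc) (k ∘ suc)
        head tail pairsʰ pairsᵗ : Carrier
        head = fromℤ R (k zero) * θ (γ zero)
        tail = sumFin R m (λ i → fromℤ R (k (suc i)) * θ (γ (suc i)))
        pairsʰ = sumFin R m (λ j → (fromℤ R (k zero) * fromℤ R (k (suc j))) * θ (commutator Γ (γ zero) (γ (suc j))))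
        pairsᵗ = sumPairs R m (λ i j → (fromℤ R (k (suc i)) * fromℤ R (k (suc j)))
                                       * θ (commutator Γ (γ (suc i)) (γ (suc j))))

corollary2p5 : ∀ {a b c ℓ} (Γ : Group a b) (R : CommutativeRing c ℓ) →
  let module Γ = Group Γ
      module R = CommutativeRing R
  in
  -- an element 1/2 of the scalar ring (ℝ in the paper)
  (half : R.Carrier) → (half R.+ half) R.≈ R.1# →
  -- modular symbol γ ↦ ⟨γ,f⟩ ∈ ℂ, given as (real part , imaginary part); additive in γ
  (sym : Γ.Carrier → R.Carrier × R.Carrier) →
  (∀ {g t} → g Γ.≈ t → (proj₁ (sym g) R.≈ proj₁ (sym t)) × (proj₂ (sym g) R.≈ proj₂ (sym t))) →
  (∀ g t → (proj₁ (sym (g Γ.∙ t)) R.≈ (proj₁ (sym g) R.+ proj₁ (sym t)))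
         × (proj₂ (sym (g Γ.∙ t)) R.≈ (proj₂ (sym g) R.+ proj₂ (sym t)))) →
  -- the constant V_f / (2π)
  (κ : R.Carrier) →
  -- θ = S* − S, with its cocycle identity
  (θ : Γ.Carrier → R.Carrier) →
  (∀ {g t} → g Γ.≈ t → θ g R.≈ θ t) →
  (∀ g t → θ (g Γ.∙ t) R.≈
     ((θ g R.+ θ t) R.+ (κ R.* ((proj₂ (sym g) R.* proj₁ (sym t)) R.- (proj₁ (sym g) R.* proj₂ (sym t)))))) →
  ∀ (m : ℕ) (γ : Fin m → Γ.Carrier) (k : Fin m → ℤ) →
  θ (prodPow Γ m γ k) R.≈
    (sumFin R m (λ i → fromℤ R (k i) R.* θ (γ i))
     R.+ (half R.* sumPairs R m (λ i j → (fromℤ R (k i) R.* fromℤ R (k j)) R.* θ (commutator Γ (γ i) (γ j)))))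
corollary2p5 Γ R half half+half≈1 σ σ-cong σ-∙ κ θ θ-cong θ-∙ =
  QuasiMorphism.θ-prodPow Γ R (determinant-isAlternatingBiadditive Γ R re-additive im-additive κ)
    θ-cong θ-∙ half+half≈1
  where
  open MagmaMorphisms (Group.rawMagma Γ) (CommutativeRing.+-rawMagma R) using (IsMagmaHomomorphism)

  re-additive : IsMagmaHomomorphism (proj₁ ∘ σ)
  re-additive = record { isRelHomomorphism = record { cong = proj₁ ∘ σ-cong } ; homo = λ g t → proj₁ (σ-∙ g t) }

  im-additive : IsMagmaHomomorphism (proj₂ ∘ σ)
  im-additive = record { isRelHomomorphism = record { cong = proj₂ ∘ σ-cong } ; homo = λ g t → proj₂ (σ-∙ g t) }
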